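{- Let $k\in \mathbb{Z}$ and $n,j\in\mathbb{Z}^+$, and let $G=(V,E)$ be a $j$-regular simple graph. If $(j, n) \mid k$, then $\chi_{(n,k)}(G) = \chi(G)$. If $G$ is finite and $(j, n) \nmid k|V|$, then $\chi_{(n,k)}(G)$ does not exist.
   Context: $(a,b)$ denotes the greatest common divisor. A $\mathbb{Z}$-labeling of $G$ is a map $\ell:V\to\mathbb{Z}$; its order is the size of its range; it is proper if adjacent vertices get different labels; $\chi(G)$ is the minimum order of a proper labeling. $N(v)$ is the open neighborhood of $v$. An open coloring with remainder $k \bmod n$ is a labeling with $\sum_{w\in N(v)}\ell(w)\equiv k \pmod n$ for all $v\in V$. If no proper such coloring exists, $\chi_{(n,k)}(G)$ does not exist; if proper such colorings of finite order exist, $\chi_{(n,k)}(G)$ is the minimum order of one; if they exist only of infinite order, $\chi_{(n,k)}(G)=\infty$. -}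

module Defs where

open import Data.Nat using (ℕ; zero; suc; _≤_)
open import Data.Fin using (Fin; zero; suc)
open import Data.Integer using (ℤ; +_; _+_; _-_)
open import Data.Integer.Divisibility using (_∣_)
open import Data.Product using (Σ; ∃; _×_; _,_)
open import Relation.Binary.PropositionalEquality using (_≡_; _≢_)
open import Function.Definitions using (Injective)
open import Function.Bundles using (_↔_)

-- A j-regular simple graph on vertex type V, given by an enumeration of
-- each open neighbourhood: nbr v : Fin j → V is injective (exactly j
-- distinct neighbours), no loops, and adjacency is symmetric.
record RegularGraph (V : Set) (j : ℕ) : Set where
  field
    nbr      : V → Fin j → V
    nbr-inj  : ∀ v → Injective _≡_ _≡_ (nbr v)
    loopless : ∀ v i → nbr v i ≢ v
    symm     : ∀ v i → ∃ λ i′ → nbr (nbr v i) i′ ≡ v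

module _ {V : Set} {j : ℕ} (G : RegularGraph V j) where
  open RegularGraph G

  Adj : V → V → Set
  Adj v w = ∃ λ i → nbr v i ≡ w

Σℤ : ∀ {m} → (Fin m → ℤ) → ℤ
Σℤ {zero}  f = + 0
Σℤ {suc m} f = f zero + Σℤ (λ i → f (suc i))

Labeling : Set → Set
Labeling V = V → ℤ

_≡_[mod_] : ℤ → ℤ → ℕ → Set
a ≡ b [mod n ] = (+ n) ∣ (a - b)

-- the order (size of the range) of ℓ is exactly m:
-- the range is the image of an injective f : Fin m → ℤ
HasOrder : {V : Set} → Labeling V → ℕ → Set
HasOrder {V} ℓ m = Σ (Fin m → ℤ) λ f →
  Injective _≡_ _≡_ f × (∀ v → ∃ λ i → f i ≡ ℓ v) × (∀ i → ∃ λ v → ℓ v ≡ f i)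

module _ {V : Set} {j : ℕ} (G : RegularGraph V j) where
  open RegularGraph G

  Proper : Labeling V → Set
  Proper ℓ = ∀ v w → Adj G v w → ℓ v ≢ ℓ w

  OpenColoring : ℕ → ℤ → Labeling V → Set
  OpenColoring n k ℓ = ∀ v → Σℤ (λ i → ℓ (nbr v i)) ≡ k [mod n ]

  ProperOpen : ℕ → ℤ → Labeling V → Set
  ProperOpen n k ℓ = Proper ℓ × OpenColoring n k ℓ

IsMinOrder : {V : Set} → (Labeling V → Set) → ℕ → Set
IsMinOrder {V} P m =
  (∃ λ ℓ → P ℓ × HasOrder ℓ m) ×
  (∀ ℓ m′ → P ℓ → HasOrder ℓ m′ → m ≤ m′)

-- Equality of the extended invariants defined by two classes of labelings:
-- same existence (so "does not exist" agrees), and the same minimum order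
-- for every finite m (so finite values and the value ∞ agree).
SameInvariant : {V : Set} → (Labeling V → Set) → (Labeling V → Set) → Set
SameInvariant {V} P Q =
  ((∃ λ ℓ → P ℓ) → (∃ λ ℓ → Q ℓ)) × ((∃ λ ℓ → Q ℓ) → (∃ λ ℓ → P ℓ)) ×
  (∀ m → (IsMinOrder P m → IsMinOrder Q m) × (IsMinOrder Q m → IsMinOrder P m))

{-# OPTIONS --safe #-}

-- If gcd(j,n) ∣ k, Bézout gives b with j·b ≡ k (mod n), and the injective relabelling
-- x ↦ n·x + b turns every proper labeling into a proper open coloring with remainder k of
-- the same order; since proper open colorings are in particular proper, the two invariants
-- coincide. Conversely, summing the neighbourhood sums of an open coloring ℓ over a finite
-- vertex set counts every ℓ(w) once per neighbour of w, giving j·Σℓ ≡ |V|·k (mod n), and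
-- gcd(j,n) divides both j and n.

module Submission where

open import Defs
open import Data.Nat using (ℕ; _≤_)
open import Data.Nat.GCD using (gcd)
open import Data.Integer using (ℤ; +_; _*_)
open import Data.Integer.Divisibility using (_∣_)
open import Data.Fin using (Fin)
open import Data.Product using (∃; _×_)
open import Function.Bundles using (_↔_)
open import Relation.Nullary using (¬_)

open import Data.Nat as ℕ using (zero; suc; NonZero; >-nonZero)
open import Data.Nat.GCD using (gcd[m,n]∣m; gcd[m,n]∣n; gcd-GCD; module Bézout)
open import Data.Integer using (_+_; _-_; -_)
import Data.Integer.Properties as ℤP
open import Data.Integer.Divisibility.Signed as Signed
  using (divides; ∣ᵤ⇒∣; ∣⇒∣ᵤ; ∣-refl; ∣-trans; ∣m∣n⇒∣m+n; ∣m∣n⇒∣m-n; ∣m⇒∣m*n)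
open import Data.Integer.Tactic.RingSolver using (solve-∀)
open import Algebra.Properties.Semiring.Sum ℤP.+-*-semiring
  using (sum; sum-syntax; sum-cong-≗; sum-remove; sum-replicate-zero;
         ∑-distrib-+; ∑-comm; *-distribˡ-sum; *-distribʳ-sum)
open import Algebra.Properties.AbelianGroup ℤP.+-0-abelianGroup using (∙-cancelʳ)
open import Data.Fin using (zero; suc; punchIn; _≟_)
open import Data.Fin.Properties using (punchInᵢ≢i; any?)
open import Data.Product using (_,_; ∃₂)
open import Function.Base using (_∘_)
open import Function.Bundles using (Inverse)
open import Function.Definitions using (Injective)
open import Function.Properties.Inverse using (↔⇒↣)
open import Relation.Nullary using (Dec; yes; no; contradiction)
open import Relation.Nullary.Decidable using (via-injection)
open import Relation.Binary.Definitions using (DecidableEquality)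
open import Relation.Binary.PropositionalEquality
  using (_≡_; refl; sym; trans; cong; cong₂; subst; subst₂; module ≡-Reasoning)
open ≡-Reasoning

pos-d+ab≡ce : ∀ d a b c e → d ℕ.+ a ℕ.* b ≡ c ℕ.* e → + d + + a * + b ≡ + c * + e
pos-d+ab≡ce d a b c e eq = begin
  + d + + a * + b       ≡⟨ cong (_+_ (+ d)) (ℤP.pos-* a b) ⟨
  + d + + (a ℕ.* b)     ≡⟨ ℤP.pos-+ d (a ℕ.* b) ⟨
  + (d ℕ.+ a ℕ.* b)     ≡⟨ cong +_ eq ⟩
  + (c ℕ.* e)           ≡⟨ ℤP.pos-* c e ⟩
  + c * + e             ∎

bézout : ∀ m n → ∃₂ λ x y → + gcd m n ≡ x * + m + y * + n
bézout m n with Bézout.identity (gcd-GCD m n)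
... | Bézout.+- x y eq = + x , - + y , (begin
  + d                              ≡⟨ d≡[d+yn]-yn (+ d) (+ y) (+ n) ⟩
  (+ d + + y * + n) + - + y * + n  ≡⟨ cong (_+ - + y * + n) (pos-d+ab≡ce d y n x m eq) ⟩
  + x * + m + - + y * + n          ∎)
  where
  d : ℕ
  d = gcd m n
  d≡[d+yn]-yn : ∀ d y n → d ≡ (d + y * n) + - y * n
  d≡[d+yn]-yn = solve-∀
... | Bézout.-+ x y eq = - + x , + y , (begin
  + d                              ≡⟨ d≡-xm+[d+xm] (+ d) (+ x) (+ m) ⟩
  - + x * + m + (+ d + + x * + m)  ≡⟨ cong (_+_ (- + x * + m)) (pos-d+ab≡ce d x m y n eq) ⟩
  - + x * + m + + y * + n          ∎)
  where
  d : ℕ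
  d = gcd m n
  d≡-xm+[d+xm] : ∀ d x m → d ≡ - x * m + (d + x * m)
  d≡-xm+[d+xm] = solve-∀

linear-congruence-solvable : ∀ j n {k} → + gcd j n Signed.∣ k → ∃ λ b → + n Signed.∣ + j * b - k
linear-congruence-solvable j n (divides t refl) with bézout j n
... | x , y , d≡xj+yn = t * x , divides (- (t * y)) (begin
  + j * (t * x) - t * + gcd j n          ≡⟨ cong (λ d → + j * (t * x) - t * d) d≡xj+yn ⟩
  + j * (t * x) - t * (x * + j + y * + n) ≡⟨ rearrange (+ j) (+ n) t x y ⟩
  - (t * y) * + n                        ∎)
  where
  rearrange : ∀ j n t x y → j * (t * x) - t * (x * j + y * n) ≡ - (t * y) * n
  rearrange = solve-∀

∣-resp-≡[mod] : ∀ {d n a b} → d Signed.∣ n → n Signed.∣ a - b → d Signed.∣ a → d Signed.∣ b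
∣-resp-≡[mod] {a = a} {b} d∣n n∣a-b d∣a =
  subst (_ Signed.∣_) (a-[a-b]≡b a b) (∣m∣n⇒∣m-n d∣a (∣-trans d∣n n∣a-b))
  where
  a-[a-b]≡b : ∀ a b → a - (a - b) ≡ b
  a-[a-b]≡b = solve-∀

Σℤ≡sum : ∀ {m} (f : Fin m → ℤ) → Σℤ f ≡ sum f
Σℤ≡sum {zero}  f = refl
Σℤ≡sum {suc m} f = cong (_+_ (f zero)) (Σℤ≡sum (f ∘ suc))

sum-const : ∀ m (c : ℤ) → ∑[ i < m ] c ≡ + m * c
sum-const zero    c = refl
sum-const (suc m) c = trans (cong (_+_ c) (sum-const m c)) (sym (ℤP.suc-* (+ m) c))

sum-resp-≡[mod] : ∀ {m d} (f g : Fin m → ℤ) → (∀ i → d Signed.∣ f i - g i) →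
  d Signed.∣ sum f - sum g
sum-resp-≡[mod] {zero}  f g d∣ = divides (+ 0) refl
sum-resp-≡[mod] {suc m} f g d∣ =
  subst (_ Signed.∣_) (interchange (f zero) (g zero) (sum (f ∘ suc)) (sum (g ∘ suc)))
    (∣m∣n⇒∣m+n (d∣ zero) (sum-resp-≡[mod] (f ∘ suc) (g ∘ suc) (d∣ ∘ suc)))
  where
  interchange : ∀ a b c d → (a - b) + (c - d) ≡ (a + c) - (b + d)
  interchange = solve-∀

𝟙 : ∀ {A : Set} → Dec A → ℤ
𝟙 (yes _) = + 1
𝟙 (no _)  = + 0

𝟙-yes : ∀ {A : Set} (a? : Dec A) → A → 𝟙 a? ≡ + 1
𝟙-yes (yes _) _ = refl
𝟙-yes (no ¬a) a = contradiction a ¬a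

𝟙-no : ∀ {A : Set} (a? : Dec A) → ¬ A → 𝟙 a? ≡ + 0
𝟙-no (yes a) ¬a = contradiction a ¬a
𝟙-no (no _)  _  = refl

𝟙-cong : ∀ {A B : Set} → (A → B) → (B → A) → (a? : Dec A) (b? : Dec B) → 𝟙 a? ≡ 𝟙 b?
𝟙-cong A→B B→A (yes a) b? = sym (𝟙-yes b? (A→B a))
𝟙-cong A→B B→A (no ¬a) b? = sym (𝟙-no b? (¬a ∘ B→A))

sum-δ : ∀ {m} (b : Fin m) (h : Fin m → ℤ) → ∑[ a < m ] (𝟙 (b ≟ a) * h a) ≡ h b
sum-δ {suc m} b h = begin
  sum t                          ≡⟨ sum-remove t ⟩
  t b + sum (t ∘ punchIn b)      ≡⟨ cong₂ _+_ (cong (_* h b) (𝟙-yes (b ≟ b) refl)) off-diagonal ⟩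
  + 1 * h b + + 0                ≡⟨ ℤP.+-identityʳ _ ⟩
  + 1 * h b                      ≡⟨ ℤP.*-identityˡ (h b) ⟩
  h b                            ∎
  where
  t : Fin (suc m) → ℤ
  t a = 𝟙 (b ≟ a) * h a
  off-diagonal : sum (t ∘ punchIn b) ≡ + 0
  off-diagonal = trans
    (sum-cong-≗ (λ a → cong (_* h (punchIn b a)) (𝟙-no (b ≟ punchIn b a) (punchInᵢ≢i b a ∘ sym))))
    (sum-replicate-zero m)

module Counting {V : Set} {N : ℕ} (enum : V ↔ Fin N) where
  open Inverse enum using (to; from; inverseˡ; inverseʳ; strictlyInverseʳ)

  _≟V_ : DecidableEquality V
  _≟V_ = via-injection (↔⇒↣ enum) _≟_

  ∑V : (V → ℤ) → ℤ
  ∑V F = ∑[ a < N ] F (from a)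

  ∑V-δ : ∀ u (h : V → ℤ) → ∑V (λ w → 𝟙 (u ≟V w) * h w) ≡ h u
  ∑V-δ u h = begin
    ∑[ a < N ] (𝟙 (u ≟V from a) * h (from a))
      ≡⟨ sum-cong-≗ (λ a → cong (_* h (from a))
           (𝟙-cong inverseˡ (λ e → sym (inverseʳ (sym e))) (u ≟V from a) (to u ≟ a))) ⟩
    ∑[ a < N ] (𝟙 (to u ≟ a) * h (from a))
      ≡⟨ sum-δ (to u) (h ∘ from) ⟩
    h (from (to u))
      ≡⟨ cong h (strictlyInverseʳ u) ⟩
    h u ∎

  multiplicity : ∀ {m} → (Fin m → V) → V → ℤ
  multiplicity {m} g w = ∑[ i < m ] 𝟙 (g i ≟V w)

  sum-∘≡∑V-multiplicity : ∀ {m} (g : Fin m → V) (h : V → ℤ) →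
    ∑[ i < m ] h (g i) ≡ ∑V (λ w → multiplicity g w * h w)
  sum-∘≡∑V-multiplicity {m} g h = begin
    ∑[ i < m ] h (g i)
      ≡⟨ sum-cong-≗ (λ i → sym (∑V-δ (g i) h)) ⟩
    ∑[ i < m ] ∑V (λ w → 𝟙 (g i ≟V w) * h w)
      ≡⟨ ∑-comm (λ i a → 𝟙 (g i ≟V from a) * h (from a)) ⟩
    ∑V (λ w → ∑[ i < m ] (𝟙 (g i ≟V w) * h w))
      ≡⟨ sum-cong-≗ (λ a → sym (*-distribʳ-sum (h (from a)) (λ i → 𝟙 (g i ≟V from a)))) ⟩
    ∑V (λ w → multiplicity g w * h w) ∎

  multiplicity-injective : ∀ {m} {g : Fin m → V} → Injective _≡_ _≡_ g →
    ∀ w → multiplicity g w ≡ 𝟙 (any? (λ i → g i ≟V w))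
  multiplicity-injective {m} {g} g-inj w with any? (λ i → g i ≟V w)
  ... | yes (i , refl) = begin
    ∑[ a < m ] 𝟙 (g a ≟V g i)
      ≡⟨ sum-cong-≗ (λ a → trans (𝟙-cong (sym ∘ g-inj) (cong g ∘ sym) _ (i ≟ a))
                                 (sym (ℤP.*-identityʳ _))) ⟩
    ∑[ a < m ] (𝟙 (i ≟ a) * + 1)
      ≡⟨ sum-δ i (λ _ → + 1) ⟩
    + 1 ∎
  ... | no ∄i = trans (sum-cong-≗ (λ a → 𝟙-no (g a ≟V w) (∄i ∘ (a ,_)))) (sum-replicate-zero m)

HasOrder-∘ : ∀ {V : Set} {f : ℤ → ℤ} → Injective _≡_ _≡_ f →
  ∀ {ℓ : Labeling V} {m} → HasOrder ℓ m → HasOrder (f ∘ ℓ) m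
HasOrder-∘ {f = f} f-inj (e , e-inj , e-covers , e-attained) =
  f ∘ e , e-inj ∘ f-inj ,
  (λ v → let i , eᵢ≡ℓv = e-covers v in i , cong f eᵢ≡ℓv) ,
  (λ i → let v , ℓv≡eᵢ = e-attained i in v , cong f ℓv≡eᵢ)

affine-injective : ∀ n .{{_ : NonZero n}} b → Injective _≡_ _≡_ (λ x → + n * x + b)
affine-injective n b {x} {y} = ℤP.*-cancelˡ-≡ (+ n) x y ∘ ∙-cancelʳ b (+ n * x) (+ n * y)

⊆∧order-preserving-map⇒SameInvariant : ∀ {V : Set} {P Q : Labeling V → Set} →
  (∀ {ℓ} → P ℓ → Q ℓ) → (t : Labeling V → Labeling V) → (∀ {ℓ} → Q ℓ → P (t ℓ)) →
  (∀ {ℓ m} → HasOrder ℓ m → HasOrder (t ℓ) m) → SameInvariant P Q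
⊆∧order-preserving-map⇒SameInvariant P⇒Q t Q⇒P∘t t-order =
  (λ (ℓ , Pℓ) → ℓ , P⇒Q Pℓ) ,
  (λ (ℓ , Qℓ) → t ℓ , Q⇒P∘t Qℓ) ,
  λ m → (λ ((ℓ , Pℓ , ord) , minimal) →
           (ℓ , P⇒Q Pℓ , ord) , λ ℓ′ m′ Qℓ′ ord′ → minimal (t ℓ′) m′ (Q⇒P∘t Qℓ′) (t-order ord′)) ,
        (λ ((ℓ , Qℓ , ord) , minimal) →
           (t ℓ , Q⇒P∘t Qℓ , t-order ord) , λ ℓ′ m′ Pℓ′ ord′ → minimal ℓ′ m′ (P⇒Q Pℓ′) ord′)

module _ {V : Set} {j : ℕ} (G : RegularGraph V j) where
  open RegularGraph G

  Adj-sym : ∀ {v w} → Adj G v w → Adj G w v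
  Adj-sym {v} (i , refl) = symm v i

  affine-OpenColoring : ∀ {n k b} → + n Signed.∣ + j * b - k →
    ∀ ℓ → OpenColoring G n k (λ v → + n * ℓ v + b)
  affine-OpenColoring {n} {k} {b} n∣jb-k ℓ v =
    ∣⇒∣ᵤ (subst (+ n Signed.∣_) (sym neighbourhood-sum) (∣m∣n⇒∣m+n (∣m⇒∣m*n S ∣-refl) n∣jb-k))
    where
    S : ℤ
    S = ∑[ i < j ] ℓ (nbr v i)
    neighbourhood-sum : Σℤ (λ i → + n * ℓ (nbr v i) + b) - k ≡ + n * S + (+ j * b - k)
    neighbourhood-sum = begin
      Σℤ (λ i → + n * ℓ (nbr v i) + b) - k
        ≡⟨ cong (_- k) (Σℤ≡sum (λ i → + n * ℓ (nbr v i) + b)) ⟩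
      ∑[ i < j ] (+ n * ℓ (nbr v i) + b) - k
        ≡⟨ cong (_- k) (∑-distrib-+ (λ i → + n * ℓ (nbr v i)) (λ _ → b)) ⟩
      ∑[ i < j ] (+ n * ℓ (nbr v i)) + ∑[ i < j ] b - k
        ≡⟨ cong₂ (λ x y → x + y - k) (*-distribˡ-sum (+ n) (ℓ ∘ nbr v)) (sym (sum-const j b)) ⟨
      + n * S + + j * b - k
        ≡⟨ ℤP.+-assoc (+ n * S) (+ j * b) (- k) ⟩
      + n * S + (+ j * b - k) ∎

  Proper-∘ : ∀ {f : ℤ → ℤ} → Injective _≡_ _≡_ f → ∀ {ℓ} → Proper G ℓ → Proper G (f ∘ ℓ)
  Proper-∘ f-inj proper-ℓ v w adj = proper-ℓ v w adj ∘ f-inj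

  module _ {N : ℕ} (enum : V ↔ Fin N) where
    open Counting enum
    open Inverse enum using (from)

    multiplicity-nbr-sym : ∀ v w → multiplicity (nbr v) w ≡ multiplicity (nbr w) v
    multiplicity-nbr-sym v w = begin
      multiplicity (nbr v) w          ≡⟨ multiplicity-injective (nbr-inj v) w ⟩
      𝟙 (any? (λ i → nbr v i ≟V w))   ≡⟨ 𝟙-cong Adj-sym Adj-sym _ _ ⟩
      𝟙 (any? (λ i → nbr w i ≟V v))   ≡⟨ multiplicity-injective (nbr-inj w) v ⟨
      multiplicity (nbr w) v          ∎

    ∑V-multiplicity-nbr : ∀ w → ∑V (λ v → multiplicity (nbr v) w) ≡ + j
    ∑V-multiplicity-nbr w = begin
      ∑V (λ v → multiplicity (nbr v) w)
        ≡⟨ sum-cong-≗ (λ a → trans (multiplicity-nbr-sym (from a) w) (sym (ℤP.*-identityʳ _))) ⟩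
      ∑V (λ v → multiplicity (nbr w) v * + 1)
        ≡⟨ sum-∘≡∑V-multiplicity (nbr w) (λ _ → + 1) ⟨
      ∑[ i < j ] (+ 1)
        ≡⟨ sum-const j (+ 1) ⟩
      + j * + 1
        ≡⟨ ℤP.*-identityʳ (+ j) ⟩
      + j ∎

    ∑V-neighbourhood-sum : ∀ ℓ → ∑V (λ v → ∑[ i < j ] ℓ (nbr v i)) ≡ + j * ∑V ℓ
    ∑V-neighbourhood-sum ℓ = begin
      ∑V (λ v → ∑[ i < j ] ℓ (nbr v i))
        ≡⟨ sum-cong-≗ (λ a → sum-∘≡∑V-multiplicity (nbr (from a)) ℓ) ⟩
      ∑V (λ v → ∑V (λ w → multiplicity (nbr v) w * ℓ w))
        ≡⟨ ∑-comm (λ a b → multiplicity (nbr (from a)) (from b) * ℓ (from b)) ⟩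
      ∑V (λ w → ∑V (λ v → multiplicity (nbr v) w * ℓ w))
        ≡⟨ sum-cong-≗ (λ b → *-distribʳ-sum (ℓ (from b)) (λ a → multiplicity (nbr (from a)) (from b))) ⟨
      ∑V (λ w → ∑V (λ v → multiplicity (nbr v) w) * ℓ w)
        ≡⟨ sum-cong-≗ (λ b → cong (_* ℓ (from b)) (∑V-multiplicity-nbr (from b))) ⟩
      ∑V (λ w → + j * ℓ w)
        ≡⟨ *-distribˡ-sum (+ j) (ℓ ∘ from) ⟨
      + j * ∑V ℓ ∎

    OpenColoring⇒gcd∣k*N : ∀ {n k} ℓ → OpenColoring G n k ℓ → + gcd j n Signed.∣ k * + N
    OpenColoring⇒gcd∣k*N {n} {k} ℓ open-ℓ =
      subst (_ Signed.∣_) (ℤP.*-comm (+ N) k) (∣-resp-≡[mod] gcd∣n n∣j∑ℓ-Nk gcd∣j∑ℓ)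
      where
      gcd∣n : + gcd j n Signed.∣ + n
      gcd∣n = ∣ᵤ⇒∣ (gcd[m,n]∣n j n)
      gcd∣j∑ℓ : + gcd j n Signed.∣ + j * ∑V ℓ
      gcd∣j∑ℓ = ∣m⇒∣m*n (∑V ℓ) (∣ᵤ⇒∣ {i = + j} (gcd[m,n]∣m j n))
      n∣S-k : ∀ a → + n Signed.∣ ∑[ i < j ] ℓ (nbr (from a) i) - k
      n∣S-k a = subst (λ x → + n Signed.∣ x - k) (Σℤ≡sum (ℓ ∘ nbr (from a))) (∣ᵤ⇒∣ (open-ℓ (from a)))
      n∣j∑ℓ-Nk : + n Signed.∣ + j * ∑V ℓ - + N * k
      n∣j∑ℓ-Nk = subst₂ (λ x y → + n Signed.∣ x - y) (∑V-neighbourhood-sum ℓ) (sum-const N k)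
        (sum-resp-≡[mod] (λ a → ∑[ i < j ] ℓ (nbr (from a) i)) (λ _ → k) n∣S-k)

theorem5p5 : (k : ℤ) (n j : ℕ) → 1 ≤ n → 1 ≤ j →
    {V : Set} (G : RegularGraph V j) →
    (((+ gcd j n) ∣ k) →
       SameInvariant (ProperOpen G n k) (Proper G)) ×
    ((N : ℕ) → V ↔ Fin N → ¬ ((+ gcd j n) ∣ (k * + N)) →
       ¬ (∃ λ ℓ → ProperOpen G n k ℓ))
theorem5p5 k n j 1≤n _ {V} G = same-invariant , no-coloring
  where
  instance
    n≢0 : NonZero n
    n≢0 = >-nonZero 1≤n

  same-invariant : + gcd j n ∣ k → SameInvariant (ProperOpen G n k) (Proper G)
  same-invariant gcd∣k =
    let b , n∣jb-k = linear-congruence-solvable j n (∣ᵤ⇒∣ gcd∣k)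
        affine-inj = affine-injective n b
    in ⊆∧order-preserving-map⇒SameInvariant (λ (proper , _) → proper)
         (λ ℓ v → + n * ℓ v + b)
         (λ {ℓ} proper → Proper-∘ G affine-inj {ℓ} proper , affine-OpenColoring G n∣jb-k ℓ)
         (HasOrder-∘ affine-inj)

  no-coloring : (N : ℕ) → V ↔ Fin N → ¬ (+ gcd j n ∣ k * + N) → ¬ (∃ λ ℓ → ProperOpen G n k ℓ)
  no-coloring N enum gcd∤kN (ℓ , _ , open-ℓ) = gcd∤kN (∣⇒∣ᵤ (OpenColoring⇒gcd∣k*N G enum ℓ open-ℓ))
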